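{- A strong cocomparability graph contains no invertible pair; that is, if $G$ is a strong cocomparability graph, then there are no distinct vertices $u,v$ of $G$ with $(u,v)\sim(v,u)$.
   Context: A reflexive graph is a finite undirected graph in which every vertex has a loop. It is a strong cocomparability graph if its vertices admit a linear ordering $\prec$ such that there are no vertices $r_1\prec r_2$, $c_1\prec c_2$ with $r_1c_1\notin E$, $r_1c_2\in E$, $r_2c_1\in E$, $r_2c_2\notin E$ (i.e. its adjacency matrix, with $1$'s on the diagonal, has a simultaneous row/column permutation avoiding the submatrix $\begin{pmatrix}0&1\\1&0\end{pmatrix}$). For ordered pairs of distinct vertices, $(u,v)\,\Lambda\,(u',v')$ means $(u,v)=(u',v')$, or $uu',vv'\in E$ and $uv',vu'\notin E$; $\sim$ is the transitive closure of $\Lambda$ (there is a finite sequence of pairs from $(u,v)$ to $(u',v')$, consecutive ones related by $\Lambda$). An invertible pair is a pair of distinct vertices $u,v$ with $(u,v)\sim(v,u)$. -}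

module Defs where

open import Data.Nat using (ℕ)
open import Data.Fin using (Fin; _<_)
open import Data.Product using (_×_; ∃; Σ-syntax; _,_)
open import Data.Sum using (_⊎_)
open import Data.Empty using (⊥)
open import Level using (0ℓ)
open import Relation.Nullary using (¬_)
open import Relation.Binary.PropositionalEquality using (_≡_) renaming (sym to ≡-sym)
open import Relation.Binary.Construct.Closure.ReflexiveTransitive using (Star)
open import Function.Bundles using (_↔_)

record ReflexiveGraph (n : ℕ) : Set₁ where
  field
    E     : Fin n → Fin n → Set
    sym   : ∀ {u v} → E u v → E v u
    loop  : ∀ u → E u u

module _ {n : ℕ} (G : ReflexiveGraph n) where
  open ReflexiveGraph G

  -- A linear ordering of the vertices is given by a bijection
  -- pos : vertices ↔ Fin n (u ≺ v iff pos u < pos v).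
  IsStrongOrdering : (Fin n ↔ Fin n) → Set
  IsStrongOrdering pos =
    ∀ r₁ r₂ c₁ c₂ → pos ⟨$⟩ r₁ < pos ⟨$⟩ r₂ → pos ⟨$⟩ c₁ < pos ⟨$⟩ c₂ →
      ¬ (¬ E r₁ c₁ × E r₁ c₂ × E r₂ c₁ × ¬ E r₂ c₂)
    where open Function.Bundles.Inverse using () renaming (to to _⟨$⟩_)

  IsStrongCocomparability : Set
  IsStrongCocomparability = ∃ λ (pos : Fin n ↔ Fin n) → IsStrongOrdering pos

  Pair : Set
  Pair = Σ[ u ∈ Fin n ] Σ[ v ∈ Fin n ] ¬ (u ≡ v)

  data _Λ_ : Pair → Pair → Set where
    Λ-refl : ∀ {p} → p Λ p
    Λ-step : ∀ {u v u′ v′} (d : ¬ (u ≡ v)) (d′ : ¬ (u′ ≡ v′)) →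
             E u u′ → E v v′ → ¬ E u v′ → ¬ E v u′ →
             (u , v , d) Λ (u′ , v′ , d′)

  -- ∼ is the transitive closure of Λ (Λ is reflexive, so Star is the same).
  _∼_ : Pair → Pair → Set
  _∼_ = Star _Λ_

  HasInvertiblePair : Set
  HasInvertiblePair =
    Σ[ u ∈ Fin n ] Σ[ v ∈ Fin n ] Σ[ d ∈ ¬ (u ≡ v) ]
      ((u , v , d) ∼ (v , u , λ e → d (≡-sym e)))

{-# OPTIONS --safe #-}
-- Λ is symmetric and, for a strong ordering, a Λ-step never reverses the
-- order of a pair: a pair u ≺ v stepping to u′ ≻ v′ is exactly the
-- forbidden 2×2 pattern with rows u, v and columns v′, u′.  As ∼ is then
-- symmetric as well, whichever of (u, v), (v, u) is ascending would be
-- ∼-related to a descending pair.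
module Submission where

open import Data.Nat using (ℕ)
open import Data.Fin using (Fin; _<_)
open import Data.Fin.Properties using (<-cmp; <-asym)
open import Data.Product using (_,_)
open import Function.Bundles using (_↔_; Inverse; Injection)
open import Function.Properties.Inverse using (↔⇒↣)
open import Relation.Binary.Definitions using (Sym; tri<; tri≈; tri>)
open import Relation.Binary.PropositionalEquality using (_≡_)
open import Relation.Binary.Construct.Closure.ReflexiveTransitive using (ε; _◅_; reverse)
open import Relation.Nullary using (¬_)
open import Defs

module _ {n : ℕ} (G : ReflexiveGraph n) where
  open ReflexiveGraph G using (E; sym)

  Λ-sym : Sym (_Λ_ G) (_Λ_ G)
  Λ-sym Λ-refl = Λ-refl
  Λ-sym (Λ-step d d′ euu′ evv′ ¬euv′ ¬evu′) =
    Λ-step d′ d (sym euu′) (sym evv′) (λ e → ¬evu′ (sym e)) (λ e → ¬euv′ (sym e))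

  module _ (pos : Fin n ↔ Fin n) (strong : IsStrongOrdering G pos) where
    open Inverse pos using (to)

    Ascending : Pair G → Set
    Ascending (u , v , _) = to u < to v

    to-injective : ∀ {u v} → to u ≡ to v → u ≡ v
    to-injective = Injection.injective (↔⇒↣ pos)

    Λ-preserves-Ascending : ∀ {p q} → _Λ_ G p q → Ascending p → Ascending q
    Λ-preserves-Ascending Λ-refl u≺v = u≺v
    Λ-preserves-Ascending {u , v , _} {u′ , v′ , u′≢v′}
                          (Λ-step _ _ euu′ evv′ ¬euv′ ¬evu′) u≺v
      with <-cmp (to u′) (to v′)
    ... | tri< u′≺v′ _ _ = u′≺v′
    ... | tri≈ _ u′≡v′ _ with () ← u′≢v′ (to-injective u′≡v′)
    ... | tri> _ _ v′≺u′ with () ← strong u v v′ u′ u≺v v′≺u′ (¬euv′ , euu′ , evv′ , ¬evu′)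

    ∼-preserves-Ascending : ∀ {p q} → _∼_ G p q → Ascending p → Ascending q
    ∼-preserves-Ascending ε           asc = asc
    ∼-preserves-Ascending (step ◅ st) asc =
      ∼-preserves-Ascending st (Λ-preserves-Ascending step asc)

    noInvertiblePair : ¬ HasInvertiblePair G
    noInvertiblePair (u , v , u≢v , inv) with <-cmp (to u) (to v)
    ... | tri< u≺v _ _ = <-asym u≺v (∼-preserves-Ascending inv u≺v)
    ... | tri≈ _ u≡v _ = u≢v (to-injective u≡v)
    ... | tri> _ _ v≺u = <-asym v≺u (∼-preserves-Ascending (reverse Λ-sym inv) v≺u)

proposition9 : (n : ℕ) (G : ReflexiveGraph n) →
    IsStrongCocomparability G → ¬ HasInvertiblePair G
proposition9 n G (pos , strong) = noInvertiblePair G pos strong
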